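{- Let $D$ be a digraph having a source. Then there exists an integer $m \geq 2$ such that the $m$-step competition graph $C^m(D)$ is connected and triangle-free if and only if $D$ is a star-generating digraph with exactly one source. Moreover, if $D$ is a star-generating digraph with exactly one source, then $C^1(D)$ is also connected and triangle-free.
   Context: All digraphs are finite, may have loops, and (standing assumption) every vertex has outdegree at least $1$. For a positive integer $m$, a vertex $y$ is an $m$-step prey of $x$ (and $x$ an $m$-step predator of $y$) if there is a directed walk of length $m$ from $x$ to $y$; $1$-step prey/predators are called prey/predators. The $m$-step competition graph $C^m(D)$ has vertex set $V(D)$ and an edge between distinct vertices $x,y$ iff they have a common $m$-step prey. A source is a vertex of indegree $0$. $D$ is weakly connected if its underlying undirected graph is connected. A weakly connected digraph $D$ is star-generating if: ($S_1$) $D$ has at least one source and, for each source $v$, each prey of $v$ has exactly two predators; ($S_2$) no two sources of $D$ have a common prey; ($S_3$) each non-source vertex has exactly one prey and exactly two predators, one of which is a source and the other of which is a non-source vertex. -}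

module Defs where

open import Data.Nat using (ℕ; zero; suc)
open import Data.Fin using (Fin)
open import Data.Bool using (Bool; true)
open import Data.Product using (Σ; ∃; ∃-syntax; _×_; _,_)
open import Data.Sum using (_⊎_)
open import Relation.Nullary using (¬_)
open import Relation.Binary.PropositionalEquality using (_≡_; _≢_)
open import Relation.Binary.Construct.Closure.ReflexiveTransitive using (Star)

-- A finite digraph (loops allowed) on vertex set Fin n, given by a
-- Boolean adjacency function: Arc D x y means there is an arc x → y.
Digraph : ℕ → Set
Digraph n = Fin n → Fin n → Bool

module _ {n : ℕ} (D : Digraph n) where

  Arc : Fin n → Fin n → Set
  Arc x y = D x y ≡ true

  -- standing assumption: every vertex has outdegree at least 1
  OutdegreePositive : Set
  OutdegreePositive = ∀ x → ∃[ y ] Arc x y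

  Walk : ℕ → Fin n → Fin n → Set
  Walk zero x y = x ≡ y
  Walk (suc m) x y = ∃[ z ] (Arc x z × Walk m z y)

  StepPrey : ℕ → Fin n → Fin n → Set
  StepPrey m x y = Walk m x y

  Source : Fin n → Set
  Source v = ∀ x → ¬ Arc x v

  HasSource : Set
  HasSource = ∃[ v ] Source v

  ExactlyOneSource : Set
  ExactlyOneSource = ∃[ s ] (Source s × (∀ t → Source t → t ≡ s))

  WeaklyConnected : Set
  WeaklyConnected = ∀ u v → Star (λ a b → Arc a b ⊎ Arc b a) u v

  ExactlyTwoPredators : Fin n → Set
  ExactlyTwoPredators y =
    ∃[ a ] ∃[ b ] (a ≢ b × Arc a y × Arc b y × (∀ c → Arc c y → c ≡ a ⊎ c ≡ b))

  ExactlyOnePrey : Fin n → Set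
  ExactlyOnePrey x = ∃[ y ] (Arc x y × (∀ z → Arc x z → z ≡ y))

  S₁ : Set
  S₁ = HasSource × (∀ v → Source v → ∀ y → Arc v y → ExactlyTwoPredators y)

  S₂ : Set
  S₂ = ∀ u v → Source u → Source v → u ≢ v → ¬ (∃[ y ] (Arc u y × Arc v y))

  S₃ : Set
  S₃ = ∀ x → ¬ Source x →
         ExactlyOnePrey x ×
         ExactlyTwoPredators x ×
         (∃[ a ] ∃[ b ] (Source a × ¬ Source b × Arc a x × Arc b x))

  StarGenerating : Set
  StarGenerating = WeaklyConnected × S₁ × S₂ × S₃

-- simple undirected graphs on Fin n given by an (irreflexive, symmetric) edge relation
Connected : {n : ℕ} → (Fin n → Fin n → Set) → Set
Connected {n} E = ∀ (u v : Fin n) → Star E u v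

TriangleFree : {n : ℕ} → (Fin n → Fin n → Set) → Set
TriangleFree {n} E = ¬ (∃[ x ] ∃[ y ] ∃[ z ] (E x y × E y z × E x z))

CompEdge : {n : ℕ} → Digraph n → ℕ → Fin n → Fin n → Set
CompEdge D m x y = x ≢ y × ∃[ z ] (StepPrey D m x z × StepPrey D m y z)

-- If s is the only source of a star-generating digraph, then s → y for every y ≠ s and every
-- y ≠ s has exactly one other predecessor, itself a non-source; so for m ≥ 1 the m-step predators
-- of y ≠ s are s and a single non-source, and C^m(D) is the star centred at s.
--
-- Conversely, let s be a source and C^m(D), m ≥ 2, connected and triangle-free, i.e. no vertex
-- has three m-step predators. Map each v ≠ s to a common m-step prey of v and its parent in a
-- breadth-first spanning tree of C^m(D) rooted at s. Two tree edges cannot share a prey, so the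
-- map is injective, and as s is no m-step prey it is onto the vertices ≠ s. Hence s is the only
-- source, every y ≠ s has exactly two m-step predators, and two vertices share at most one m-step
-- prey. Writing m = (k + 1) + j, a second injection, combined with induction along the tree,
-- shows that every v ≠ s has two distinct (k + 1)-step predators. For k + 1 = m − 1 this forces
-- each non-source to have a single prey, and for k + 1 = 1 it forces s → v and a unique
-- non-source predator of v.

module Submission where

open import Defs
open import Data.Nat using (ℕ; zero; suc; _+_; _≤_; _<_; z≤n; s≤s)
open import Data.Nat.Properties
  using ( 1+n≰n; +-suc; +-comm; +-identityʳ; ≤-refl; ≤-pred; ≮⇒≥; <-asym; <-irrefl
        ; ≤-<-trans; <-≤-trans; m<1+n⇒m<n∨m≡n )
open import Data.Fin using (Fin; punchOut)
open import Data.Fin.Properties using (any?; punchOut-injective; injective⇒≤) renaming (_≟_ to _≟F_)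
open import Data.Bool using (true) renaming (_≟_ to _≟B_)
open import Data.Product using (∃-syntax; _×_; _,_; proj₁; proj₂)
open import Data.Sum using (_⊎_; inj₁; inj₂; map₂)
open import Data.Empty using (⊥; ⊥-elim)
open import Relation.Nullary using (¬_; Dec; yes; no)
open import Relation.Nullary.Decidable using (_×-dec_; ¬?; _⊎-dec_; toSum)
open import Relation.Binary.Definitions using (Decidable; Symmetric)
open import Relation.Binary.PropositionalEquality
  using (_≡_; _≢_; refl; sym; trans; cong; subst; ≢-sym)
open import Relation.Binary.Construct.Closure.ReflexiveTransitive using (Star; ε; _◅_)
open import Function.Definitions using (Injective)
open import Function.Bundles using (_⇔_; mk⇔)

Least : (ℕ → Set) → ℕ → Set
Least P e = P e × (∀ f → f < e → ¬ P f)

least : (P : ℕ → Set) → (∀ d → Dec (P d)) → ∀ {d} → P d → ∃[ e ] Least P e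
least P P? {d} pd = search 0 d refl (λ _ ())
  where
  search : ∀ k i → k + i ≡ d → (∀ f → f < k → ¬ P f) → ∃[ e ] Least P e
  search k i k+i≡d below with P? k
  search k i k+i≡d below | yes pk = k , pk , below
  search k zero k+0≡d below | no ¬pk =
    ⊥-elim (¬pk (subst P (trans (sym k+0≡d) (+-identityʳ k)) pd))
  search k (suc i) k+1+i≡d below | no ¬pk = search (suc k) i (trans (sym (+-suc k i)) k+1+i≡d) below′
    where
    below′ : ∀ f → f < suc k → ¬ P f
    below′ f f<1+k with m<1+n⇒m<n∨m≡n f<1+k
    ... | inj₁ f<k = below f f<k
    ... | inj₂ refl = ¬pk

injective⇒surjective : ∀ {n} {f : Fin n → Fin n} → Injective _≡_ _≡_ f →
                       ∀ y → ∃[ x ] f x ≡ y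
injective⇒surjective {zero} _ ()
injective⇒surjective {suc n} {f} f-injective y with any? (λ x → f x ≟F y)
... | yes hit = hit
... | no miss = ⊥-elim (1+n≰n (injective⇒≤ punched-injective))
  where
  f≢y : ∀ x → y ≢ f x
  f≢y x y≡fx = miss (x , sym y≡fx)
  punched : Fin (suc n) → Fin n
  punched x = punchOut (f≢y x)
  punched-injective : Injective _≡_ _≡_ punched
  punched-injective {x} {x′} eq = f-injective (punchOut-injective (f≢y x) (f≢y x′) eq)

module _ {n : ℕ} (r : Fin n) (f : Fin n → Fin n) (avoids : ∀ {v} → v ≢ r → f v ≢ r)
         (injective : ∀ {v w} → v ≢ r → w ≢ r → f v ≡ f w → v ≡ w) where

  private
    extended : Fin n → Fin n
    extended v with v ≟F r
    ... | yes _ = r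
    ... | no _ = f v

    extended-injective : Injective _≡_ _≡_ extended
    extended-injective {v} {w} eq with v ≟F r | w ≟F r
    ... | yes v≡r | yes w≡r = trans v≡r (sym w≡r)
    ... | yes _ | no w≢r = ⊥-elim (avoids w≢r (sym eq))
    ... | no v≢r | yes _ = ⊥-elim (avoids v≢r eq)
    ... | no v≢r | no w≢r = injective v≢r w≢r eq

  injectiveOffPoint⇒surjectiveOffPoint : ∀ {t} → t ≢ r → ∃[ v ] (v ≢ r × f v ≡ t)
  injectiveOffPoint⇒surjectiveOffPoint {t} t≢r with injective⇒surjective extended-injective t
  ... | v , ext-v≡t with v ≟F r
  ...   | yes _ = ⊥-elim (t≢r (sym ext-v≡t))
  ...   | no v≢r = v , v≢r , ext-v≡t

atNonRoot : ∀ {n} (r : Fin n) → (∀ v → v ≢ r → Fin n) → Fin n → Fin n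
atNonRoot r f v with v ≟F r
... | yes _ = v
... | no v≢r = f v v≢r

atNonRoot-spec : ∀ {n} {r : Fin n} {f : ∀ v → v ≢ r → Fin n} (P : Fin n → Fin n → Set) →
                 (∀ v v≢r → P v (f v v≢r)) → ∀ {v} → v ≢ r → P v (atNonRoot r f v)
atNonRoot-spec {r = r} P spec {v} v≢r with v ≟F r
... | yes v≡r = ⊥-elim (v≢r v≡r)
... | no v≢r′ = spec v v≢r′

SamePair : ∀ {A : Set} → A → A → A → A → Set
SamePair c d a b = (c ≡ a × d ≡ b) ⊎ (c ≡ b × d ≡ a)

samePair : ∀ {A : Set} {a b c d : A} → c ≢ d → (c ≡ a ⊎ c ≡ b) → (d ≡ a ⊎ d ≡ b) →
           SamePair c d a b
samePair c≢d (inj₁ c≡a) (inj₁ d≡a) = ⊥-elim (c≢d (trans c≡a (sym d≡a)))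
samePair _ (inj₁ c≡a) (inj₂ d≡b) = inj₁ (c≡a , d≡b)
samePair _ (inj₂ c≡b) (inj₁ d≡a) = inj₂ (c≡b , d≡a)
samePair c≢d (inj₂ c≡b) (inj₂ d≡b) = ⊥-elim (c≢d (trans c≡b (sym d≡b)))

samePair-other : ∀ {A : Set} {a b c d x : A} → SamePair c d a b → (x ≡ a ⊎ x ≡ b) → x ≢ c →
                 x ≡ d
samePair-other (inj₁ (c≡a , _)) (inj₁ x≡a) x≢c = ⊥-elim (x≢c (trans x≡a (sym c≡a)))
samePair-other (inj₁ (_ , d≡b)) (inj₂ x≡b) _ = trans x≡b (sym d≡b)
samePair-other (inj₂ (_ , d≡a)) (inj₁ x≡a) _ = trans x≡a (sym d≡a)
samePair-other (inj₂ (c≡b , _)) (inj₂ x≡b) x≢c = ⊥-elim (x≢c (trans x≡b (sym c≡b)))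

hub⇒connected : ∀ {n} {E : Fin n → Fin n → Set} (r : Fin n) →
                (∀ v → v ≢ r → E r v × E v r) → Connected E
hub⇒connected r hub u v with u ≟F r | v ≟F r
... | yes refl | yes refl = ε
... | yes refl | no v≢r = proj₁ (hub v v≢r) ◅ ε
... | no u≢r | yes refl = proj₂ (hub u u≢r) ◅ ε
... | no u≢r | no v≢r = proj₂ (hub u u≢r) ◅ proj₁ (hub v v≢r) ◅ ε

record RootedSpanningTree {n : ℕ} (E : Fin n → Fin n → Set) (r : Fin n) : Set where
  field
    parent : Fin n → Fin n
    depth : Fin n → ℕ
    parent-edge : ∀ v → v ≢ r → E (parent v) v
    depth-parent : ∀ v → v ≢ r → depth (parent v) < depth v

  ≢parent : ∀ {v} → v ≢ r → v ≢ parent v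
  ≢parent v≢r v≡pv = <-irrefl (cong depth (sym v≡pv)) (depth-parent _ v≢r)

  no-2-cycle : ∀ {v w} → v ≢ r → w ≢ r → v ≡ parent w → w ≡ parent v → ⊥
  no-2-cycle {v} {w} v≢r w≢r v≡pw w≡pv =
    <-asym (subst (λ x → depth x < depth v) (sym w≡pv) (depth-parent v v≢r))
           (subst (λ x → depth x < depth w) (sym v≡pw) (depth-parent w w≢r))

  parent-induction : (P : Fin n → Set) → (∀ v → (v ≢ r → P (parent v)) → P v) →
                     ∀ v → P v
  parent-induction P step v = bounded (suc (depth v)) v ≤-refl
    where
    bounded : ∀ fuel v → depth v < fuel → P v
    bounded (suc fuel) v d<1+fuel =
      step v (λ v≢r → bounded fuel (parent v) (<-≤-trans (depth-parent v v≢r) (≤-pred d<1+fuel)))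

module _ {n : ℕ} {E : Fin n → Fin n → Set} (E? : Decidable E) (r : Fin n) where

  Layer : ℕ → Fin n → Set
  Layer zero v = v ≡ r
  Layer (suc d) v = Layer d v ⊎ ∃[ u ] (Layer d u × E u v)

  layer? : ∀ d v → Dec (Layer d v)
  layer? zero v = v ≟F r
  layer? (suc d) v = layer? d v ⊎-dec any? (λ u → layer? d u ×-dec E? u v)

  star⇒layer : ∀ {d u v} → Layer d u → Star E u v → ∃[ e ] Layer e v
  star⇒layer l ε = _ , l
  star⇒layer l (e ◅ p) = star⇒layer (inj₂ (_ , l , e)) p

  minimalLayer⇒earlierPredecessor : ∀ {v} d → Least (λ e → Layer e v) d → v ≢ r →
                                    ∃[ u ] (E u v × ∃[ e ] (e < d × Layer e u))
  minimalLayer⇒earlierPredecessor zero (v≡r , _) v≢r = ⊥-elim (v≢r v≡r)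
  minimalLayer⇒earlierPredecessor (suc d) (inj₁ l , minimal) _ = ⊥-elim (minimal d ≤-refl l)
  minimalLayer⇒earlierPredecessor (suc d) (inj₂ (u , l , u→v) , _) _ = u , u→v , d , ≤-refl , l

  -- Opaque: with-abstractions over terms mentioning the tree would otherwise unfold the search.
  opaque
    spanningTree : (∀ v → Star E r v) → RootedSpanningTree E r
    spanningTree reach = record
      { parent = parent ; depth = depth ; parent-edge = parent-edge ; depth-parent = depth-parent }
      where
      minimalLayer : ∀ v → ∃[ d ] Least (λ e → Layer e v) d
      minimalLayer v =
        least (λ d → Layer d v) (λ d → layer? d v) (proj₂ (star⇒layer refl (reach v)))

      depth : Fin n → ℕ
      depth v = proj₁ (minimalLayer v)

      depth-minimal : ∀ {e u} → Layer e u → depth u ≤ e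
      depth-minimal {e} {u} l = ≮⇒≥ (λ e<d → proj₂ (proj₂ (minimalLayer u)) e e<d l)

      entry : ∀ v → v ≢ r → ∃[ u ] (E u v × ∃[ e ] (e < depth v × Layer e u))
      entry v = minimalLayer⇒earlierPredecessor (depth v) (proj₂ (minimalLayer v))

      parent : Fin n → Fin n
      parent = atNonRoot r (λ v v≢r → proj₁ (entry v v≢r))

      parent-spec : ∀ {v} → v ≢ r → E (parent v) v × depth (parent v) < depth v
      parent-spec = atNonRoot-spec (λ v u → E u v × depth u < depth v)
                                   (λ v v≢r → let _ , u→v , e , e<d , l = entry v v≢r
                                              in u→v , ≤-<-trans (depth-minimal l) e<d)

      parent-edge : ∀ v → v ≢ r → E (parent v) v
      parent-edge v v≢r = proj₁ (parent-spec v≢r)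

      depth-parent : ∀ v → v ≢ r → depth (parent v) < depth v
      depth-parent v v≢r = proj₂ (parent-spec v≢r)

module Walks {n : ℕ} (D : Digraph n) where

  arc? : Decidable (Arc D)
  arc? x y = D x y ≟B true

  walk? : ∀ k → Decidable (Walk D k)
  walk? zero x y = x ≟F y
  walk? (suc k) x y = any? (λ z → arc? x z ×-dec walk? k z y)

  walk-cast : ∀ {k l x y} → k ≡ l → Walk D k x y → Walk D l x y
  walk-cast refl w = w

  walk-++ : ∀ k {l x y z} → Walk D k x y → Walk D l y z → Walk D (k + l) x z
  walk-++ zero refl w = w
  walk-++ (suc k) (u , x→u , w₁) w₂ = u , x→u , walk-++ k w₁ w₂

  walk-split : ∀ k {l x z} → Walk D (k + l) x z → ∃[ y ] (Walk D k x y × Walk D l y z)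
  walk-split zero w = _ , refl , w
  walk-split (suc k) (u , x→u , w) with walk-split k w
  ... | y , w₁ , w₂ = y , (u , x→u , w₁) , w₂

  walk-snoc : ∀ k {x y z} → Walk D k x y → Arc D y z → Walk D (suc k) x z
  walk-snoc zero refl y→z = _ , y→z , refl
  walk-snoc (suc k) (u , x→u , w) y→z = u , x→u , walk-snoc k w y→z

  walk-unsnoc : ∀ k {x z} → Walk D (suc k) x z → ∃[ y ] (Walk D k x y × Arc D y z)
  walk-unsnoc zero (u , x→u , refl) = _ , refl , x→u
  walk-unsnoc (suc k) (u , x→u , w) with walk-unsnoc k w
  ... | y , w′ , y→z = y , (u , x→u , w′) , y→z

  walk-target-not-source : ∀ k {x z} → Walk D (suc k) x z → ¬ Source D z
  walk-target-not-source k w z-source with walk-unsnoc k w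
  ... | y , _ , y→z = z-source y y→z

  walk-exists : OutdegreePositive D → ∀ k x → ∃[ z ] Walk D k x z
  walk-exists _ zero x = x , refl
  walk-exists outdeg (suc k) x with outdeg x
  ... | u , x→u with walk-exists outdeg k u
  ...   | z , w = z , u , x→u , w

  compEdge? : ∀ k → Decidable (CompEdge D k)
  compEdge? k x y = ¬? (x ≟F y) ×-dec any? (λ z → walk? k x z ×-dec walk? k y z)

  compEdge-sym : ∀ k → Symmetric (CompEdge D k)
  compEdge-sym k (x≢y , z , wx , wy) = (λ y≡x → x≢y (sym y≡x)) , z , wy , wx

  TwoPredators : ℕ → Fin n → Set
  TwoPredators k y = ∃[ a ] ∃[ b ] (a ≢ b × Walk D k a y × Walk D k b y)

  twoPredators? : ∀ k y → Dec (TwoPredators k y)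
  twoPredators? k y = any? (λ a → any? (λ b → ¬? (a ≟F b) ×-dec (walk? k a y ×-dec walk? k b y)))

module StarGenerated {n : ℕ} (D : Digraph n) (outdeg : OutdegreePositive D) (sg : StarGenerating D)
                     {s : Fin n} (s-source : Source D s) (s-unique : ∀ t → Source D t → t ≡ s) where
  open Walks D

  private
    s₃ : S₃ D
    s₃ = proj₂ (proj₂ (proj₂ sg))

  ≢s⇒¬source : ∀ {x} → x ≢ s → ¬ Source D x
  ≢s⇒¬source x≢s x-source = x≢s (s-unique _ x-source)

  root-arc : ∀ {x} → ¬ Source D x → Arc D s x
  root-arc {x} x-ns with s₃ x x-ns
  ... | _ , _ , a , _ , a-source , _ , a→x , _ = subst (λ a → Arc D a x) (s-unique a a-source) a→x

  nonSource-predecessor : ∀ {x} → ¬ Source D x → ∃[ b ] (¬ Source D b × Arc D b x)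
  nonSource-predecessor {x} x-ns with s₃ x x-ns
  ... | _ , _ , _ , b , _ , b-ns , _ , b→x = b , b-ns , b→x

  nonSource-predecessor-unique : ∀ {x c c′} → ¬ Source D x → ¬ Source D c → ¬ Source D c′ →
                                 Arc D c x → Arc D c′ x → c ≡ c′
  nonSource-predecessor-unique {x} x-ns c-ns c′-ns c→x c′→x with s₃ x x-ns
  ... | _ , (a , b , _ , _ , _ , only-a-b) , (a₀ , b₀ , a₀-source , b₀-ns , a₀→x , b₀→x) =
    trans (≡b₀ c-ns c→x) (sym (≡b₀ c′-ns c′→x))
    where
    pair : SamePair a₀ b₀ a b
    pair = samePair (λ a₀≡b₀ → b₀-ns (subst (Source D) a₀≡b₀ a₀-source))
                    (only-a-b a₀ a₀→x) (only-a-b b₀ b₀→x)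
    ≡b₀ : ∀ {c} → ¬ Source D c → Arc D c x → c ≡ b₀
    ≡b₀ c-ns c→x = samePair-other pair (only-a-b _ c→x)
                                  (λ c≡a₀ → c-ns (subst (Source D) (sym c≡a₀) a₀-source))

  root-walk : ∀ k {z} → ¬ Source D z → Walk D (suc k) s z
  root-walk zero {z} z-ns = z , root-arc z-ns , refl
  root-walk (suc k) z-ns with nonSource-predecessor z-ns
  ... | b , b-ns , b→z = walk-snoc (suc k) (root-walk k b-ns) b→z

  root-adjacent : ∀ k {x} → x ≢ s → CompEdge D (suc k) s x
  root-adjacent k {x} x≢s with walk-exists outdeg (suc k) x
  ... | z , x⇝z = ≢-sym x≢s , z , root-walk k (walk-target-not-source k x⇝z) , x⇝z

  nonSource-walks-injective : ∀ k {x y z} → ¬ Source D x → ¬ Source D y →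
                              Walk D k x z → Walk D k y z → x ≡ y
  nonSource-walks-injective zero _ _ refl refl = refl
  nonSource-walks-injective (suc k) x-ns y-ns (u , x→u , wx) (u′ , y→u′ , wy)
    with nonSource-walks-injective k (λ u-source → u-source _ x→u) (λ u′-source → u′-source _ y→u′)
                                   wx wy
  ... | refl = nonSource-predecessor-unique (λ u-source → u-source _ x→u) x-ns y-ns x→u y→u′

  nonRoot-nonadjacent : ∀ k {x y} → x ≢ s → y ≢ s → ¬ CompEdge D k x y
  nonRoot-nonadjacent k x≢s y≢s (x≢y , _ , wx , wy) =
    x≢y (nonSource-walks-injective k (≢s⇒¬source x≢s) (≢s⇒¬source y≢s) wx wy)

  connected : ∀ k → Connected (CompEdge D (suc k))
  connected k =
    hub⇒connected s (λ v v≢s → root-adjacent k v≢s , compEdge-sym (suc k) (root-adjacent k v≢s))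

  triangleFree : ∀ k → TriangleFree (CompEdge D k)
  triangleFree k (x , y , z , xy , yz , xz) with x ≟F s | y ≟F s
  ... | no x≢s | no y≢s = nonRoot-nonadjacent k x≢s y≢s xy
  ... | yes refl | _ = nonRoot-nonadjacent k (≢-sym (proj₁ xy)) (≢-sym (proj₁ xz)) yz
  ... | no x≢s | yes refl = nonRoot-nonadjacent k x≢s (≢-sym (proj₁ yz)) xz

module ConnectedTriangleFree {n : ℕ} (D : Digraph n) (outdeg : OutdegreePositive D)
                             {s : Fin n} (s-source : Source D s) (m′ : ℕ)
                             (connected : Connected (CompEdge D (2 + m′)))
                             (triangleFree : TriangleFree (CompEdge D (2 + m′))) where
  open Walks D

  m : ℕ
  m = 2 + m′

  walk-target-≢s : ∀ k {a t} → Walk D (suc k) a t → t ≢ s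
  walk-target-≢s k w refl = walk-target-not-source k w s-source

  third-predator : ∀ {a b c z} → a ≢ b → Walk D m a z → Walk D m b z → Walk D m c z →
                   c ≡ a ⊎ c ≡ b
  third-predator {a} {b} {c} {z} a≢b wa wb wc with c ≟F a | c ≟F b
  ... | yes c≡a | _ = inj₁ c≡a
  ... | no _ | yes c≡b = inj₂ c≡b
  ... | no c≢a | no c≢b =
    ⊥-elim (triangleFree (a , b , c , (a≢b , z , wa , wb) , (≢-sym c≢b , z , wb , wc) ,
                          (≢-sym c≢a , z , wa , wc)))

  tree : RootedSpanningTree (CompEdge D m) s
  tree = spanningTree (compEdge? m) s (connected s)

  open RootedSpanningTree tree

  opaque
    edgePrey : Fin n → Fin n
    edgePrey = atNonRoot s (λ v v≢s → proj₁ (proj₂ (parent-edge v v≢s)))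

    edgePrey-predators : ∀ {v} → v ≢ s → Walk D m v (edgePrey v) × Walk D m (parent v) (edgePrey v)
    edgePrey-predators =
      atNonRoot-spec (λ v t → Walk D m v t × Walk D m (parent v) t)
                     (λ v v≢s → let _ , _ , parent⇝ , v⇝ = parent-edge v v≢s in v⇝ , parent⇝)

  edgePrey-≢s : ∀ {v} → v ≢ s → edgePrey v ≢ s
  edgePrey-≢s v≢s = walk-target-≢s (suc m′) (proj₁ (edgePrey-predators v≢s))

  edgePrey-pair : ∀ {v a b} → v ≢ s → a ≢ b → Walk D m a (edgePrey v) → Walk D m b (edgePrey v) →
                  SamePair v (parent v) a b
  edgePrey-pair v≢s a≢b wa wb =
    samePair (≢parent v≢s) (third-predator a≢b wa wb (proj₁ (edgePrey-predators v≢s)))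
                           (third-predator a≢b wa wb (proj₂ (edgePrey-predators v≢s)))

  treeEdge-pair-injective : ∀ {v v′ a b} → v ≢ s → v′ ≢ s →
                            SamePair v (parent v) a b → SamePair v′ (parent v′) a b → v ≡ v′
  treeEdge-pair-injective _ _ (inj₁ (v≡a , _)) (inj₁ (v′≡a , _)) = trans v≡a (sym v′≡a)
  treeEdge-pair-injective v≢s v′≢s (inj₁ (v≡a , pv≡b)) (inj₂ (v′≡b , pv′≡a)) =
    ⊥-elim (no-2-cycle v≢s v′≢s (trans v≡a (sym pv′≡a)) (trans v′≡b (sym pv≡b)))
  treeEdge-pair-injective v≢s v′≢s (inj₂ (v≡b , pv≡a)) (inj₁ (v′≡a , pv′≡b)) =
    ⊥-elim (no-2-cycle v≢s v′≢s (trans v≡b (sym pv′≡b)) (trans v′≡a (sym pv≡a)))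
  treeEdge-pair-injective _ _ (inj₂ (v≡b , _)) (inj₂ (v′≡b , _)) = trans v≡b (sym v′≡b)

  edgePrey-injective : ∀ {v v′} → v ≢ s → v′ ≢ s → edgePrey v ≡ edgePrey v′ → v ≡ v′
  edgePrey-injective {v} {v′} v≢s v′≢s eq =
    treeEdge-pair-injective v≢s v′≢s
      (edgePrey-pair v≢s (≢parent v′≢s) (subst (Walk D m v′) (sym eq) v′⇝)
                                        (subst (Walk D m (parent v′)) (sym eq) parent⇝))
      (inj₁ (refl , refl))
    where
    v′⇝ = proj₁ (edgePrey-predators v′≢s)
    parent⇝ = proj₂ (edgePrey-predators v′≢s)

  treeEdge-of : ∀ {t} → t ≢ s → ∃[ v ] (v ≢ s × edgePrey v ≡ t)
  treeEdge-of = injectiveOffPoint⇒surjectiveOffPoint s edgePrey edgePrey-≢s edgePrey-injective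

  nonRoot-not-source : ∀ {t} → t ≢ s → ¬ Source D t
  nonRoot-not-source t≢s with treeEdge-of t≢s
  ... | v , v≢s , refl = walk-target-not-source (suc m′) (proj₁ (edgePrey-predators v≢s))

  source-unique : ∀ t → Source D t → t ≡ s
  source-unique t t-source with t ≟F s
  ... | yes t≡s = t≡s
  ... | no t≢s = ⊥-elim (nonRoot-not-source t≢s t-source)

  nonRoot-twoPredators : ∀ {t} → t ≢ s → TwoPredators m t
  nonRoot-twoPredators t≢s with treeEdge-of t≢s
  ... | v , v≢s , refl = v , parent v , ≢parent v≢s , edgePrey-predators v≢s

  predatorPair-treeEdge : ∀ {a b t} → a ≢ b → Walk D m a t → Walk D m b t →
                          ∃[ v ] (v ≢ s × edgePrey v ≡ t × SamePair v (parent v) a b)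
  predatorPair-treeEdge a≢b wa wb with treeEdge-of (walk-target-≢s (suc m′) wa)
  ... | v , v≢s , refl = v , v≢s , refl , edgePrey-pair v≢s a≢b wa wb

  commonPrey-unique : ∀ {a b t t′} → a ≢ b → Walk D m a t → Walk D m b t →
                      Walk D m a t′ → Walk D m b t′ → t ≡ t′
  commonPrey-unique a≢b wa wb wa′ wb′
    with predatorPair-treeEdge a≢b wa wb | predatorPair-treeEdge a≢b wa′ wb′
  ... | v , v≢s , refl , pair | v′ , v′≢s , refl , pair′ =
    cong edgePrey (treeEdge-pair-injective v≢s v′≢s pair pair′)

  nonRoot-nonRootPredecessor : ∀ {y} → y ≢ s → ∃[ w ] (w ≢ s × Arc D w y)
  nonRoot-nonRootPredecessor y≢s with nonRoot-twoPredators y≢s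
  ... | a , _ , _ , a⇝y , _ with walk-unsnoc (suc m′) a⇝y
  ...   | w , a⇝w , w→y = w , walk-target-≢s m′ a⇝w , w→y

  module Splitting (k j : ℕ) (k+j≡m : suc k + j ≡ m) where

    walk-k++j : ∀ {a r y} → Walk D (suc k) a r → Walk D j r y → Walk D m a y
    walk-k++j a⇝r r⇝y = walk-cast k+j≡m (walk-++ (suc k) a⇝r r⇝y)

    walk-j++k : ∀ {r y z} → Walk D j r y → Walk D (suc k) y z → Walk D m r z
    walk-j++k r⇝y y⇝z = walk-cast (trans (+-comm j (suc k)) k+j≡m) (walk-++ j r⇝y y⇝z)

    walk-k+j-split : ∀ {a y} → Walk D m a y → ∃[ r ] (Walk D (suc k) a r × Walk D j r y)
    walk-k+j-split a⇝y = walk-split (suc k) (walk-cast (sym k+j≡m) a⇝y)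

    Covered : Fin n → Set
    Covered y = ∃[ r ] (Walk D j r y × TwoPredators (suc k) r)

    covered? : ∀ y → Dec (Covered y)
    covered? y = any? (λ r → walk? j r y ×-dec twoPredators? (suc k) r)

    SplitEdge : Fin n → Fin n → Set
    SplitEdge y c = c ≢ s × parent c ≢ s × Walk D j c y × Walk D j (parent c) y ×
                    ∃[ a ] ∃[ b ] (a ≢ b × Walk D (suc k) a c × Walk D (suc k) b (parent c))

    -- The (k+1)-step midpoints of the two m-step predators of y are distinct, as y is uncovered,
    -- and share an m-step prey beyond y, so they form a tree edge.
    uncovered⇒splitEdge : ∀ {y} → y ≢ s → ¬ Covered y → ∃[ c ] SplitEdge y c
    uncovered⇒splitEdge {y} y≢s uncovered
      with nonRoot-twoPredators y≢s | walk-exists outdeg (suc k) y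
    ... | a , b , a≢b , a⇝y , b⇝y | z , y⇝z with walk-k+j-split a⇝y | walk-k+j-split b⇝y
    ...   | r₁ , a⇝r₁ , r₁⇝y | r₂ , b⇝r₂ , r₂⇝y
      with predatorPair-treeEdge (λ { refl → uncovered (r₁ , r₁⇝y , a , b , a≢b , a⇝r₁ , b⇝r₂) })
                                 (walk-j++k r₁⇝y y⇝z) (walk-j++k r₂⇝y y⇝z)
    ...     | c , c≢s , _ , inj₁ (refl , refl) =
      c , c≢s , walk-target-≢s k b⇝r₂ , r₁⇝y , r₂⇝y , a , b , a≢b , a⇝r₁ , b⇝r₂
    ...     | c , c≢s , _ , inj₂ (refl , refl) =
      c , c≢s , walk-target-≢s k a⇝r₁ , r₂⇝y , r₁⇝y , b , a , ≢-sym a≢b , b⇝r₂ , a⇝r₁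

    twoPredators-≢s : ∀ {r} → TwoPredators (suc k) r → r ≢ s
    twoPredators-≢s (_ , _ , _ , a⇝r , _) = walk-target-≢s k a⇝r

    Label : Fin n → Fin n → Set
    Label y o = (y ≡ s × o ≡ s)
              ⊎ (Walk D j o y × TwoPredators (suc k) o)
              ⊎ (¬ Covered y × SplitEdge y o)

    label : ∀ y → ∃[ o ] Label y o
    label y with y ≟F s | covered? y
    ... | yes y≡s | _ = s , inj₁ (y≡s , refl)
    ... | no _ | yes (r , r⇝y , two) = r , inj₂ (inj₁ (r⇝y , two))
    ... | no y≢s | no uncovered = let c , edge = uncovered⇒splitEdge y≢s uncovered
                                  in c , inj₂ (inj₂ (uncovered , edge))

    label-injective : ∀ {y y′ o} → Label y o → Label y′ o → y ≡ y′
    label-injective (inj₁ (y≡s , _)) (inj₁ (y′≡s , _)) = trans y≡s (sym y′≡s)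
    label-injective (inj₁ (_ , o≡s)) (inj₂ (inj₁ (_ , two))) = ⊥-elim (twoPredators-≢s two o≡s)
    label-injective (inj₁ (_ , o≡s)) (inj₂ (inj₂ (_ , o≢s , _))) = ⊥-elim (o≢s o≡s)
    label-injective (inj₂ (inj₁ (_ , two))) (inj₁ (_ , o≡s)) = ⊥-elim (twoPredators-≢s two o≡s)
    label-injective (inj₂ (inj₂ (_ , o≢s , _))) (inj₁ (_ , o≡s)) = ⊥-elim (o≢s o≡s)
    label-injective (inj₂ (inj₁ (o⇝y , a , b , a≢b , a⇝o , b⇝o))) (inj₂ (inj₁ (o⇝y′ , _))) =
      commonPrey-unique a≢b (walk-k++j a⇝o o⇝y) (walk-k++j b⇝o o⇝y)
                            (walk-k++j a⇝o o⇝y′) (walk-k++j b⇝o o⇝y′)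
    label-injective (inj₂ (inj₁ (_ , two))) (inj₂ (inj₂ (uncovered′ , _ , _ , o⇝y′ , _))) =
      ⊥-elim (uncovered′ (_ , o⇝y′ , two))
    label-injective (inj₂ (inj₂ (uncovered , _ , _ , o⇝y , _))) (inj₂ (inj₁ (_ , two′))) =
      ⊥-elim (uncovered (_ , o⇝y , two′))
    label-injective (inj₂ (inj₂ (_ , _ , _ , o⇝y , p⇝y , a , b , a≢b , a⇝o , b⇝p)))
                    (inj₂ (inj₂ (_ , _ , _ , o⇝y′ , p⇝y′ , _))) =
      commonPrey-unique a≢b (walk-k++j a⇝o o⇝y) (walk-k++j b⇝p p⇝y)
                            (walk-k++j a⇝o o⇝y′) (walk-k++j b⇝p p⇝y′)

    labelOf : Fin n → Fin n
    labelOf y = proj₁ (label y)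

    labelOf-injective : Injective _≡_ _≡_ labelOf
    labelOf-injective {y} {y′} eq =
      label-injective (proj₂ (label y)) (subst (Label y′) (sym eq) (proj₂ (label y′)))

    labelled : ∀ o → ∃[ y ] Label y o
    labelled o with injective⇒surjective labelOf-injective o
    ... | y , refl = y , proj₂ (label y)

    -- v labels some y; a split-edge label would make y covered through parent v.
    nonRoot-twoPredators-at : ∀ {v} → v ≢ s → TwoPredators (suc k) v
    nonRoot-twoPredators-at {v} = parent-induction (λ v → v ≢ s → TwoPredators (suc k) v) step v
      where
      step : ∀ v → (v ≢ s → parent v ≢ s → TwoPredators (suc k) (parent v)) →
             v ≢ s → TwoPredators (suc k) v
      step v ih v≢s with labelled v
      ... | _ , inj₁ (_ , v≡s) = ⊥-elim (v≢s v≡s)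
      ... | _ , inj₂ (inj₁ (_ , two)) = two
      ... | _ , inj₂ (inj₂ (uncovered , _ , pv≢s , _ , pv⇝y , _)) =
        ⊥-elim (uncovered (parent v , pv⇝y , ih v≢s pv≢s))

  open Splitting using (nonRoot-twoPredators-at)

  successor-unique : ∀ {y y₁ y₂} → y ≢ s → Arc D y y₁ → Arc D y y₂ → y₁ ≡ y₂
  successor-unique y≢s y→y₁ y→y₂
    with nonRoot-twoPredators-at m′ 1 (cong suc (+-comm m′ 1)) y≢s
  ... | a , b , a≢b , a⇝y , b⇝y =
    commonPrey-unique a≢b (walk-snoc (suc m′) a⇝y y→y₁) (walk-snoc (suc m′) b⇝y y→y₁)
                          (walk-snoc (suc m′) a⇝y y→y₂) (walk-snoc (suc m′) b⇝y y→y₂)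

  opaque
    predecessor : Fin n → Fin n
    predecessor = atNonRoot s (λ y y≢s → proj₁ (nonRoot-nonRootPredecessor y≢s))

    predecessor-arc : ∀ {y} → y ≢ s → predecessor y ≢ s × Arc D (predecessor y) y
    predecessor-arc =
      atNonRoot-spec (λ y w → w ≢ s × Arc D w y) (λ y y≢s → proj₂ (nonRoot-nonRootPredecessor y≢s))

  predecessor-injective : ∀ {y y′} → y ≢ s → y′ ≢ s → predecessor y ≡ predecessor y′ → y ≡ y′
  predecessor-injective y≢s y′≢s eq =
    successor-unique (proj₁ (predecessor-arc y≢s)) (proj₂ (predecessor-arc y≢s))
                     (subst (λ w → Arc D w _) (sym eq) (proj₂ (predecessor-arc y′≢s)))

  predecessor-onto : ∀ {a} → a ≢ s → ∃[ y ] (y ≢ s × predecessor y ≡ a)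
  predecessor-onto =
    injectiveOffPoint⇒surjectiveOffPoint s predecessor (λ y≢s → proj₁ (predecessor-arc y≢s))
                                         predecessor-injective

  nonRoot-predecessor-unique : ∀ {a y} → a ≢ s → Arc D a y → a ≡ predecessor y
  nonRoot-predecessor-unique {a} {y} a≢s a→y =
    let y′ , y′≢s , py′≡a = predecessor-onto a≢s
        a→y′ = subst (λ w → Arc D w y′) py′≡a (proj₂ (predecessor-arc y′≢s))
    in trans (sym py′≡a) (cong predecessor (successor-unique a≢s a→y′ a→y))

  root-arc : ∀ {y} → y ≢ s → Arc D s y
  root-arc y≢s with nonRoot-twoPredators-at 0 (suc m′) refl y≢s
  ... | a , b , a≢b , (_ , a→y , refl) , (_ , b→y , refl) with a ≟F s | b ≟F s
  ...   | yes refl | _ = a→y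
  ...   | no _ | yes refl = b→y
  ...   | no a≢s | no b≢s =
    ⊥-elim (a≢b (trans (nonRoot-predecessor-unique a≢s a→y)
                       (sym (nonRoot-predecessor-unique b≢s b→y))))

  nonRoot-exactlyTwoPredators : ∀ {y} → y ≢ s → ExactlyTwoPredators D y
  nonRoot-exactlyTwoPredators {y} y≢s =
    s , predecessor y , ≢-sym pred≢s , root-arc y≢s , pred→y , only-s-or-predecessor
    where
    pred≢s = proj₁ (predecessor-arc y≢s)
    pred→y = proj₂ (predecessor-arc y≢s)
    only-s-or-predecessor : ∀ c → Arc D c y → c ≡ s ⊎ c ≡ predecessor y
    only-s-or-predecessor c c→y =
      map₂ (λ c≢s → nonRoot-predecessor-unique c≢s c→y) (toSum (c ≟F s))

  starGenerating : StarGenerating D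
  starGenerating = weaklyConnected , ((s , s-source) , s₁) , s₂ , s₃
    where
    weaklyConnected : WeaklyConnected D
    weaklyConnected = hub⇒connected s (λ v v≢s → inj₁ (root-arc v≢s) , inj₂ (root-arc v≢s))
    s₁ : ∀ v → Source D v → ∀ y → Arc D v y → ExactlyTwoPredators D y
    s₁ v _ y v→y = nonRoot-exactlyTwoPredators (walk-target-≢s 0 (y , v→y , refl))
    s₂ : S₂ D
    s₂ u v u-source v-source u≢v _ =
      u≢v (trans (source-unique u u-source) (sym (source-unique v v-source)))
    s₃ : S₃ D
    s₃ x x-ns =
      (y , x→y , λ z x→z → successor-unique x≢s x→z x→y) ,
      nonRoot-exactlyTwoPredators x≢s ,
      (s , predecessor x , s-source , nonRoot-not-source (proj₁ (predecessor-arc x≢s)) ,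
       root-arc x≢s , proj₂ (predecessor-arc x≢s))
      where
      x≢s : x ≢ s
      x≢s x≡s = x-ns (subst (Source D) (sym x≡s) s-source)
      y = proj₁ (outdeg x)
      x→y = proj₂ (outdeg x)

  exactlyOneSource : ExactlyOneSource D
  exactlyOneSource = s , s-source , source-unique

starGenerating⇒connectedTriangleFree : ∀ {n} (D : Digraph n) → OutdegreePositive D →
  StarGenerating D × ExactlyOneSource D →
  ∀ k → Connected (CompEdge D (suc k)) × TriangleFree (CompEdge D (suc k))
starGenerating⇒connectedTriangleFree D outdeg (sg , s , s-source , s-unique) k =
  let open StarGenerated D outdeg sg s-source s-unique in connected k , triangleFree (suc k)

connectedTriangleFree⇒starGenerating : ∀ {n} (D : Digraph n) → OutdegreePositive D → HasSource D →
  ∀ {m} → 2 ≤ m → Connected (CompEdge D m) → TriangleFree (CompEdge D m) →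
  StarGenerating D × ExactlyOneSource D
connectedTriangleFree⇒starGenerating D outdeg (s , s-source) {suc (suc m′)} (s≤s (s≤s z≤n))
                                     connected triangleFree =
  let open ConnectedTriangleFree D outdeg s-source m′ connected triangleFree
  in starGenerating , exactlyOneSource

theorem1p3 : ∀ (n : ℕ) (D : Digraph n) → OutdegreePositive D → HasSource D →
    ((∃[ m ] (2 ≤ m × Connected (CompEdge D m) × TriangleFree (CompEdge D m)))
      ⇔ (StarGenerating D × ExactlyOneSource D))
    × (StarGenerating D × ExactlyOneSource D →
        Connected (CompEdge D 1) × TriangleFree (CompEdge D 1))
theorem1p3 n D outdeg hasSource =
  mk⇔ (λ (_ , 2≤m , connected , triangleFree) →
         connectedTriangleFree⇒starGenerating D outdeg hasSource 2≤m connected triangleFree)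
      (λ starGenerating →
         2 , s≤s (s≤s z≤n) , starGenerating⇒connectedTriangleFree D outdeg starGenerating 1)
  , λ starGenerating → starGenerating⇒connectedTriangleFree D outdeg starGenerating 0
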